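{- Let $G$ be a finite simple graph of order $n\geq 3$ and $\overline{G}$ its complement. If $G$ is isomorphic to $S_{n-1}$, $S_{n-1}^+$, or $S(n-3,1)$, then $\gamma_{\rm ri2}(\overline{G})\leq 3$.
   Context: A 2RiDF of a graph $G$ is a function $f: V(G)\to\{0,1,2\}$ such that for each $i\in\{1,2\}$ the set $\{v:f(v)=i\}$ is independent and every vertex $v$ with $f(v)=0$ has a neighbor $u$ with $f(u)=i$; its weight is the number of vertices with nonzero value, and $\gamma_{\rm ri2}(G)$ is the minimum weight of a 2RiDF of $G$. The star $S_m$ is $K_{1,m}$; $S_m^+$ is $S_m$ with one additional edge (joining two leaves). For $n\geq m\geq 0$, the double star $S(n,m)$ has vertex set $\{u_0,\ldots,u_n,v_0,\ldots,v_m\}$ and edge set $\{u_0v_0\}\cup\{u_0u_i: 1\le i\le n\}\cup\{v_0v_j:1\le j\le m\}$ (so $S(n-3,1)$ requires $n\geq 4$). -}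

module Defs where

open import Data.Nat using (ℕ; zero; suc; _+_; _≤_)
open import Data.Fin using (Fin; toℕ)
open import Data.Fin.Properties using (_≟_)
open import Data.Bool using (Bool; true; false; not; _∧_; _∨_)
open import Data.Bool.Properties using (∨-comm)
open import Data.List using (List; map; allFin)
open import Data.Nat.ListAction using (sum)
open import Data.Product using (Σ; _×_; _,_; ∃)
open import Data.Sum using (_⊎_)
open import Relation.Binary.PropositionalEquality using (_≡_; refl; cong₂; sym)
open import Relation.Nullary using (yes; no)
open import Relation.Nullary.Decidable using (⌊_⌋)
open import Function.Bundles using (_↔_; Inverse)

record Graph (n : ℕ) : Set where
  field
    adj    : Fin n → Fin n → Bool
    adj-sym    : ∀ u v → adj u v ≡ adj v u
    adj-irrefl : ∀ v → adj v v ≡ false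
open Graph public

complement : ∀ {n} → Graph n → Graph n
complement {n} G = record { adj = a ; adj-sym = s ; adj-irrefl = i }
  where
  a : Fin n → Fin n → Bool
  a u v = not ⌊ u ≟ v ⌋ ∧ not (adj G u v)
  eqb : ∀ u v → ⌊ u ≟ v ⌋ ≡ ⌊ v ≟ u ⌋
  eqb u v with u ≟ v | v ≟ u
  ... | yes _ | yes _ = refl
  ... | no _ | no _ = refl
  ... | yes p | no q = Data.Empty.⊥-elim (q (sym p))
    where import Data.Empty
  ... | no p | yes q = Data.Empty.⊥-elim (p (sym q))
    where import Data.Empty
  s : ∀ u v → a u v ≡ a v u
  s u v = cong₂ (λ x y → not x ∧ not y) (eqb u v) (adj-sym G u v)
  i : ∀ v → a v v ≡ false
  i v with v ≟ v
  ... | yes _ = refl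
  ... | no p = Data.Empty.⊥-elim (p refl)
    where import Data.Empty

_≅_ : ∀ {n} → Graph n → Graph n → Set
_≅_ {n} G H = Σ (Fin n ↔ Fin n) λ π →
  ∀ u v → adj G u v ≡ adj H (Inverse.to π u) (Inverse.to π v)

fromEdges : (n : ℕ) (e : ℕ → ℕ → Bool) → (∀ a → e a a ≡ false) → Graph n
fromEdges n e e-irr = record
  { adj = λ u v → e (toℕ u) (toℕ v) ∨ e (toℕ v) (toℕ u)
  ; adj-sym = λ u v → ∨-comm (e (toℕ u) (toℕ v)) (e (toℕ v) (toℕ u))
  ; adj-irrefl = λ v → irr (toℕ v) }
  where
  irr : ∀ a → e a a ∨ e a a ≡ false
  irr a rewrite e-irr a = refl

-- Star S_{n-1} = K_{1,n-1} on Fin n: center 0, leaves 1..n-1.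
starE : ℕ → ℕ → Bool
starE zero (suc _) = true
starE _ _ = false

starE-irr : ∀ a → starE a a ≡ false
starE-irr zero = refl
starE-irr (suc a) = refl

Star : (n : ℕ) → Graph n
Star n = fromEdges n starE starE-irr

-- S_{n-1}^+ : the star S_{n-1} plus the edge joining leaves 1 and 2.
starPlusE : ℕ → ℕ → Bool
starPlusE zero (suc _) = true
starPlusE 1 2 = true
starPlusE _ _ = false

starPlusE-irr : ∀ a → starPlusE a a ≡ false
starPlusE-irr zero = refl
starPlusE-irr 1 = refl
starPlusE-irr (suc (suc a)) = refl

StarPlus : (n : ℕ) → Graph n
StarPlus n = fromEdges n starPlusE starPlusE-irr

-- Double star S(n-3,1) on Fin n: u₀ = 0, v₀ = 1, v₁ = 2, u₁..u_{n-3} = 3..n-1;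
-- edges u₀v₀ (0-1), v₀v₁ (1-2), u₀u_i (0-k for k ≥ 3).
dsE : ℕ → ℕ → Bool
dsE 0 1 = true
dsE 1 2 = true
dsE 0 (suc (suc (suc _))) = true
dsE _ _ = false

dsE-irr : ∀ a → dsE a a ≡ false
dsE-irr zero = refl
dsE-irr 1 = refl
dsE-irr 2 = refl
dsE-irr (suc (suc (suc a))) = refl

DoubleStar : (n : ℕ) → Graph n
DoubleStar n = fromEdges n dsE dsE-irr

data Label : Set where
  l0 l1 l2 : Label

record Is2RiDF {n : ℕ} (G : Graph n) (f : Fin n → Label) : Set where
  field
    indep₁ : ∀ u v → f u ≡ l1 → f v ≡ l1 → adj G u v ≡ false
    indep₂ : ∀ u v → f u ≡ l2 → f v ≡ l2 → adj G u v ≡ false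
    dom₁   : ∀ v → f v ≡ l0 → ∃ λ u → adj G v u ≡ true × f u ≡ l1
    dom₂   : ∀ v → f v ≡ l0 → ∃ λ u → adj G v u ≡ true × f u ≡ l2

nonzero : Label → ℕ
nonzero l0 = 0
nonzero l1 = 1
nonzero l2 = 1

weight : ∀ {n} → (Fin n → Label) → ℕ
weight {n} f = sum (map (λ v → nonzero (f v)) (allFin n))

γri2≤ : ∀ {n} → Graph n → ℕ → Set
γri2≤ G k = ∃ λ f → Is2RiDF G f × weight f ≤ k

-- In each model graph (Star, StarPlus, DoubleStar on vertices 0, 1, …) the vertices 0 and 1
-- are adjacent, and no vertex beyond 2 is adjacent to 1 or 2.  So in the complement, giving
-- 0 and 1 the label 1 and vertex 2 the label 2 makes both label classes independent, while
-- every remaining vertex sees both labels: a 2RiDF of weight 3.  Isomorphism invariance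
-- carries it over to any G isomorphic to a model graph.
module Submission where

open import Defs
open import Data.Nat using (ℕ; _≤_; zero; suc; _+_; s≤s)
open import Data.Nat.Properties using (≤-reflexive; +-0-commutativeMonoid)
open import Data.Sum using (_⊎_; inj₁; inj₂)
open import Data.Product using (_×_; _,_; proj₁; proj₂; Σ)
open import Data.Fin using (Fin; zero; suc)
open import Data.Fin.Properties using (_≟_)
open import Data.Bool using (true; false; not; _∧_)
open import Data.List using (map; allFin; tabulate)
open import Data.List.Properties using (map-tabulate)
open import Data.Nat.ListAction using (sum)
open import Relation.Binary.PropositionalEquality
open import Relation.Nullary using (yes; no)
open import Relation.Nullary.Decidable using (⌊_⌋)
open import Function.Bundles using (_↔_; Inverse; Injection)
open import Function.Base using (_∘_; id)
open import Function.Properties.Inverse using (↔⇒↣)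
open import Data.Empty using (⊥-elim)
import Algebra.Properties.CommutativeMonoid.Sum as CommutativeMonoidSum

module ℕ-Sum = CommutativeMonoidSum +-0-commutativeMonoid

sum-tabulate : ∀ n (g : Fin n → ℕ) → sum (tabulate g) ≡ ℕ-Sum.sum g
sum-tabulate zero    g = refl
sum-tabulate (suc n) g = cong (g zero +_) (sum-tabulate n (g ∘ suc))

weight≡sum : ∀ {n} (f : Fin n → Label) → weight f ≡ ℕ-Sum.sum (nonzero ∘ f)
weight≡sum {n} f = begin
  sum (map (nonzero ∘ f) (allFin n)) ≡⟨ cong sum (map-tabulate id (nonzero ∘ f)) ⟩
  sum (tabulate (nonzero ∘ f))       ≡⟨ sum-tabulate n (nonzero ∘ f) ⟩
  ℕ-Sum.sum (nonzero ∘ f)            ∎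
  where open ≡-Reasoning

weight-∘-↔ : ∀ {n} (π : Fin n ↔ Fin n) (f : Fin n → Label) → weight (f ∘ Inverse.to π) ≡ weight f
weight-∘-↔ π f = begin
  weight (f ∘ Inverse.to π)               ≡⟨ weight≡sum (f ∘ Inverse.to π) ⟩
  ℕ-Sum.sum (nonzero ∘ f ∘ Inverse.to π)  ≡⟨ sym (ℕ-Sum.sum-permute (nonzero ∘ f) π) ⟩
  ℕ-Sum.sum (nonzero ∘ f)                 ≡⟨ sym (weight≡sum f) ⟩
  weight f                                ∎
  where open ≡-Reasoning

module _ {n : ℕ} {G H : Graph n} (iso : G ≅ H) where
  private
    π = proj₁ iso
    to = Inverse.to π
    from = Inverse.from π

  Is2RiDF-∘-iso : ∀ {f} → Is2RiDF H f → Is2RiDF G (f ∘ to)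
  Is2RiDF-∘-iso {f} r = record
    { indep₁ = λ u v fu fv → trans (proj₂ iso u v) (Is2RiDF.indep₁ r (to u) (to v) fu fv)
    ; indep₂ = λ u v fu fv → trans (proj₂ iso u v) (Is2RiDF.indep₂ r (to u) (to v) fu fv)
    ; dom₁   = λ v fv → pull-neighbour (Is2RiDF.dom₁ r (to v) fv)
    ; dom₂   = λ v fv → pull-neighbour (Is2RiDF.dom₂ r (to v) fv)
    }
    where
    pull-neighbour : ∀ {v l} → Σ (Fin n) (λ u → adj H (to v) u ≡ true × f u ≡ l) →
                     Σ (Fin n) (λ u → adj G v u ≡ true × f (to u) ≡ l)
    pull-neighbour {v} (u , vu , fu) = from u , adjG , trans (cong f to∘from) fu
      where
      to∘from : to (from u) ≡ u
      to∘from = Inverse.strictlyInverseˡ π u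
      adjG : adj G v (from u) ≡ true
      adjG = trans (proj₂ iso v (from u)) (subst (λ w → adj H (to v) w ≡ true) (sym to∘from) vu)

  γri2≤-cong : ∀ {k} → γri2≤ H k → γri2≤ G k
  γri2≤-cong (f , r , wf≤k) =
    f ∘ to , Is2RiDF-∘-iso r , subst (_≤ _) (sym (weight-∘-↔ π f)) wf≤k

⌊≟⌋-↔ : ∀ {n} (π : Fin n ↔ Fin n) u v → ⌊ u ≟ v ⌋ ≡ ⌊ Inverse.to π u ≟ Inverse.to π v ⌋
⌊≟⌋-↔ π u v with u ≟ v | Inverse.to π u ≟ Inverse.to π v
... | yes _   | yes _     = refl
... | no _    | no _      = refl
... | yes u≡v | no πu≢πv  = ⊥-elim (πu≢πv (cong (Inverse.to π) u≡v))
... | no u≢v  | yes πu≡πv = ⊥-elim (u≢v (Injection.injective (↔⇒↣ π) πu≡πv))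

complement-cong : ∀ {n} (G H : Graph n) → G ≅ H → complement G ≅ complement H
complement-cong G H (π , adj-π) =
  π , λ u v → cong₂ (λ x y → not x ∧ not y) (⌊≟⌋-↔ π u v) (adj-π u v)

γri2≤-complement-cong : ∀ {n k} {G H : Graph n} → G ≅ H →
  γri2≤ (complement H) k → γri2≤ (complement G) k
γri2≤-complement-cong {G = G} {H} iso =
  γri2≤-cong {G = complement G} {H = complement H} (complement-cong G H iso)

label₀₁₂ : ∀ {n} → Fin n → Label
label₀₁₂ zero             = l1
label₀₁₂ (suc zero)       = l1
label₀₁₂ (suc (suc zero)) = l2
label₀₁₂ _                = l0

weight-label₀₁₂ : ∀ k → weight (label₀₁₂ {3 + k}) ≡ 3
weight-label₀₁₂ k =
  trans (weight≡sum (label₀₁₂ {3 + k})) (cong (3 +_) (ℕ-Sum.sum-replicate-zero k))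

label₀₁₂-2RiDF-complement : ∀ {k} (H : Graph (3 + k)) →
  adj H zero (suc zero) ≡ true →
  (∀ w → adj H (suc (suc (suc w))) (suc zero) ≡ false) →
  (∀ w → adj H (suc (suc (suc w))) (suc (suc zero)) ≡ false) →
  Is2RiDF (complement H) label₀₁₂
label₀₁₂-2RiDF-complement {k} H h01 h1 h2 = record
  { indep₁ = indep₁ ; indep₂ = indep₂ ; dom₁ = dom₁ ; dom₂ = dom₂ }
  where
  H̄ = complement H

  ¬01 : adj H̄ zero (suc zero) ≡ false
  ¬01 = cong not h01

  indep₁ : ∀ u v → label₀₁₂ u ≡ l1 → label₀₁₂ v ≡ l1 → adj H̄ u v ≡ false
  indep₁ zero       zero       _ _ = adj-irrefl H̄ zero
  indep₁ zero       (suc zero) _ _ = ¬01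
  indep₁ (suc zero) zero       _ _ = trans (adj-sym H̄ (suc zero) zero) ¬01
  indep₁ (suc zero) (suc zero) _ _ = adj-irrefl H̄ (suc zero)
  indep₁ zero       (suc (suc zero))    _ ()
  indep₁ zero       (suc (suc (suc _))) _ ()
  indep₁ (suc zero) (suc (suc zero))    _ ()
  indep₁ (suc zero) (suc (suc (suc _))) _ ()
  indep₁ (suc (suc zero))    _ () _
  indep₁ (suc (suc (suc _))) _ () _

  indep₂ : ∀ u v → label₀₁₂ u ≡ l2 → label₀₁₂ v ≡ l2 → adj H̄ u v ≡ false
  indep₂ (suc (suc zero)) (suc (suc zero)) _ _ = adj-irrefl H̄ (suc (suc zero))
  indep₂ zero                _ () _
  indep₂ (suc zero)          _ () _
  indep₂ (suc (suc (suc _))) _ () _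
  indep₂ (suc (suc zero)) zero                _ ()
  indep₂ (suc (suc zero)) (suc zero)          _ ()
  indep₂ (suc (suc zero)) (suc (suc (suc _))) _ ()

  dom₁ : ∀ v → label₀₁₂ v ≡ l0 → Σ (Fin (3 + k)) λ u → adj H̄ v u ≡ true × label₀₁₂ u ≡ l1
  dom₁ (suc (suc (suc w))) _ = suc zero , cong not (h1 w) , refl
  dom₁ zero             ()
  dom₁ (suc zero)       ()
  dom₁ (suc (suc zero)) ()

  dom₂ : ∀ v → label₀₁₂ v ≡ l0 → Σ (Fin (3 + k)) λ u → adj H̄ v u ≡ true × label₀₁₂ u ≡ l2
  dom₂ (suc (suc (suc w))) _ = suc (suc zero) , cong not (h2 w) , refl
  dom₂ zero             ()
  dom₂ (suc zero)       ()
  dom₂ (suc (suc zero)) ()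

γri2≤-complement-3 : ∀ {k} (H : Graph (3 + k)) →
  adj H zero (suc zero) ≡ true →
  (∀ w → adj H (suc (suc (suc w))) (suc zero) ≡ false) →
  (∀ w → adj H (suc (suc (suc w))) (suc (suc zero)) ≡ false) →
  γri2≤ (complement H) 3
γri2≤-complement-3 {k} H h01 h1 h2 =
  label₀₁₂ , label₀₁₂-2RiDF-complement H h01 h1 h2 , ≤-reflexive (weight-label₀₁₂ k)

lemma5 : (n : ℕ) → 3 ≤ n → (G : Graph n) →
    (G ≅ Star n ⊎ G ≅ StarPlus n ⊎ (4 ≤ n × G ≅ DoubleStar n)) →
    γri2≤ (complement G) 3
lemma5 (suc (suc (suc _))) _ G (inj₁ iso) =
  γri2≤-complement-cong iso (γri2≤-complement-3 (Star _) refl (λ _ → refl) (λ _ → refl))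
lemma5 (suc (suc (suc _))) _ G (inj₂ (inj₁ iso)) =
  γri2≤-complement-cong iso (γri2≤-complement-3 (StarPlus _) refl (λ _ → refl) (λ _ → refl))
lemma5 (suc (suc (suc _))) _ G (inj₂ (inj₂ (_ , iso))) =
  γri2≤-complement-cong iso (γri2≤-complement-3 (DoubleStar _) refl (λ _ → refl) (λ _ → refl))
lemma5 0                         ()             _ _
lemma5 1                         (s≤s ())       _ _
lemma5 2                         (s≤s (s≤s ())) _ _
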